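{- Let $G$ be a finite simple graph of order $n$ and size $m$, and let $k\geq 1$ be an integer. If $k\leq 2\bigl(n-\sqrt{n^{2}-n-2m}\bigr)$ or $\delta(G)\geq k-1$, then $$L_{k}(G)\leq n+\frac{k}{2}-\sqrt{\frac{k^{2}}{4}+(1-k)n+2m},$$ with equality if and only if $G\in\Omega_k$. Furthermore, if $G$ has no isolated vertex, then $\rho_{o}(G)\leq n-\sqrt{2m-n}$, with equality if and only if $G\in\Sigma$.
   Context: $\delta(G)$ is the minimum degree of $G$ and $N[v]$, $N(v)$ are the closed and open neighbourhoods of a vertex $v$. A set $B\subseteq V(G)$ is a $k$-limited packing set if $|N[v]\cap B|\leq k$ for every $v\in V(G)$; $L_k(G)$ is the maximum cardinality of such a set. A set $B\subseteq V(G)$ is an open packing if $N(u)\cap N(v)=\emptyset$ for all distinct $u,v\in B$; $\rho_o(G)$ is the maximum cardinality of an open packing. $\Omega_k$ is the family of all graphs $G$ for which there exists a clique $S\subseteq V(G)$ such that the subgraph induced by $V(G)\setminus S$ is $(k-1)$-regular and every vertex of $S$ has exactly $k$ neighbours in $V(G)\setminus S$. $\Sigma$ is the family of all graphs $G$ for which there exists a clique $S\subseteq V(G)$ such that the subgraph induced by $V(G)\setminus S$ is a disjoint union of copies of $K_2$ and every vertex of $S$ has exactly one neighbour in $V(G)\setminus S$. -}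

module Defs where

open import Data.Nat as ℕ using (ℕ; _<ᵇ_)
open import Data.Integer as ℤ using (ℤ; +_; 0ℤ)
open import Data.Bool using (Bool; true; false; _∧_)
open import Data.Fin using (Fin; toℕ)
open import Data.Fin.Subset using (Subset; ⁅_⁆; _∪_; _∩_; ∁; ∣_∣; _∈_; _∉_)
open import Data.Vec using (tabulate; sum)
open import Data.Product using (Σ; _×_)
open import Relation.Binary.PropositionalEquality using (_≡_; _≢_)
open import Relation.Nullary using (¬_)

record Graph (n : ℕ) : Set where
  field
    adj    : Fin n → Fin n → Bool
    sym    : ∀ i j → adj i j ≡ adj j i
    irrefl : ∀ i → adj i i ≡ false
open Graph public

module _ {n : ℕ} (G : Graph n) where

  N : Fin n → Subset n
  N v = tabulate (adj G v)

  NC : Fin n → Subset n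
  NC v = ⁅ v ⁆ ∪ N v

  deg : Fin n → ℕ
  deg v = ∣ N v ∣

  -- size m: number of edges {i,j}, each counted once (as j < i)
  size : ℕ
  size = sum (tabulate λ i → ∣ tabulate (λ j → (toℕ j <ᵇ toℕ i) ∧ adj G i j) ∣)

  LimitedPacking : ℕ → Subset n → Set
  LimitedPacking k B = ∀ v → ∣ NC v ∩ B ∣ ℕ.≤ k

  OpenPacking : Subset n → Set
  OpenPacking B = ∀ u v → u ∈ B → v ∈ B → u ≢ v → ∀ w → ¬ (w ∈ N u × w ∈ N v)

  Clique : Subset n → Set
  Clique S = ∀ u v → u ∈ S → v ∈ S → u ≢ v → adj G u v ≡ true

  InOmega : ℕ → Set
  InOmega k = Σ (Subset n) λ S → Clique S
    × (∀ v → v ∉ S → ∣ N v ∩ ∁ S ∣ ≡ k ℕ.∸ 1)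
    × (∀ v → v ∈ S → ∣ N v ∩ ∁ S ∣ ≡ k)

  -- G ∈ Σ  (G - S is a disjoint union of K₂'s, i.e. 1-regular)
  InSigma : Set
  InSigma = Σ (Subset n) λ S → Clique S
    × (∀ v → v ∉ S → ∣ N v ∩ ∁ S ∣ ≡ 1)
    × (∀ v → v ∈ S → ∣ N v ∩ ∁ S ∣ ≡ 1)

IsMaxCard : {n : ℕ} → (Subset n → Set) → ℕ → Set
IsMaxCard P l = (Σ _ λ B → P B × ∣ B ∣ ≡ l) × (∀ B → P B → ∣ B ∣ ℕ.≤ l)

-- Square-root comparisons over ℤ (no reals available):
-- SqrtLe a b  means  √a ≤ b   (b ≥ 0 and a ≤ b²)
-- SqrtEq a b  means  √a = b   (b ≥ 0 and a = b²; forces a ≥ 0)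
SqrtLe : ℤ → ℤ → Set
SqrtLe a b = 0ℤ ℤ.≤ b × a ℤ.≤ b ℤ.* b

SqrtEq : ℤ → ℤ → Set
SqrtEq a b = 0ℤ ℤ.≤ b × a ≡ b ℤ.* b

module Submission where

-- Let B be a maximum packing, L = ∣ B ∣, and S = V ∖ B with a = ∣ S ∣. The packings of either kind are
-- exactly the complements of the sets S in which every vertex outside S has at most p neighbours in
-- V ∖ S and every vertex of S at most q (p = k − 1, q = k for k-limited packings; p = q = 1 for open
-- packings). Summing the degrees, with every edge between S and V ∖ S counted twice from its end in S,
-- and using that a vertex of S has at most a − 1 neighbours in S, gives 2m + a ≤ pL + a(2q + a); after
-- completing the square this is the stated bound. Equality forces all these local bounds to be attained,
-- i.e. S is a clique with the degree pattern of Ω_k (resp. Σ). Conversely, for such a clique S the set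
-- V ∖ S is a packing attaining equality, and since 2q ≥ p + 1, pL + a(2q + a) − a strictly decreases as
-- L grows with L + a = n fixed, so V ∖ S is a maximum packing.

open import Defs hiding (sym)

module SubsetCounting where

  import Algebra.Lattice.Properties.BooleanAlgebra as BooleanAlgebra
  open import Data.Bool using (Bool; true; false; _∧_; not)
  open import Data.Fin using (Fin; zero; suc)
  open import Data.Fin.Subset using (Subset; inside; outside; ⁅_⁆; _∪_; _∩_; ∁; ∣_∣; _∈_; _∉_; _⊆_)
  open import Data.Fin.Subset.Properties
    using (_∈?_; nonempty?; Empty-unique; ∣⊥∣≡0; ∣⁅x⁆∣≡1; x∈⁅x⁆; ∪-identityˡ; drop-not-there; x∈p⇒x∉∁p;
           x∉p⇒x∈∁p; p⊆q⇒∣p∣≤∣q∣; p⊂q⇒∣p∣<∣q∣; x∈p∧x≢y⇒x∈p-y; x∈p⇒∣p-x∣<∣p∣; ∣∁p∣≡n∸∣p∣; ∣p∣≤n;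
           ∪-∩-booleanAlgebra)
  open import Data.Nat using (ℕ; zero; suc; _+_; _*_; _≤_; z≤n; s≤s)
  open import Data.Nat.Properties
  open import Algebra.Properties.Semiring.Sum +-*-semiring public
    using (sum; sum-syntax; ∑-distrib-+; ∑-comm; *-distribˡ-sum; *-distribʳ-sum; sum-cong-≗)
  open import Data.Product using (_×_; _,_; proj₁; proj₂)
  open import Data.Vec using (_∷_; []; here; lookup; tabulate)
  import Data.Vec as Vec
  open import Data.Vec.Properties using (lookup-map; lookup-zipWith; lookup∘tabulate; []=⇒lookup; lookup⇒[]=)
  open import Function using (_∘_)
  open import Relation.Binary.PropositionalEquality
  open import Relation.Nullary using (yes; no; contradiction)

  private variable n : ℕ

  +-mono-≤-≡⇒≡ : ∀ {a b c d} → a ≤ b → c ≤ d → a + c ≡ b + d → a ≡ b × c ≡ d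
  +-mono-≤-≡⇒≡ {a} {b} {c} {d} a≤b c≤d a+c≡b+d = a≡b , +-cancelˡ-≡ a c d (trans a+c≡b+d (cong (_+ d) (sym a≡b)))
    where
    a≡b : a ≡ b
    a≡b = ≤-antisym a≤b (+-cancelʳ-≤ d b a (subst (_≤ a + d) a+c≡b+d (+-monoʳ-≤ a c≤d)))

  ∑-mono-≤ : {f g : Fin n → ℕ} → (∀ i → f i ≤ g i) → sum f ≤ sum g
  ∑-mono-≤ {zero}  f≤g = z≤n
  ∑-mono-≤ {suc n} f≤g = +-mono-≤ (f≤g zero) (∑-mono-≤ (f≤g ∘ suc))

  ∑-mono-≤-≡⇒≡ : {f g : Fin n → ℕ} → (∀ i → f i ≤ g i) → sum f ≡ sum g → ∀ i → f i ≡ g i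
  ∑-mono-≤-≡⇒≡ {suc n} f≤g ∑f≡∑g with +-mono-≤-≡⇒≡ (f≤g zero) (∑-mono-≤ (f≤g ∘ suc)) ∑f≡∑g
  ... | f₀≡g₀ , ∑f′≡∑g′ = λ { zero → f₀≡g₀ ; (suc i) → ∑-mono-≤-≡⇒≡ (f≤g ∘ suc) ∑f′≡∑g′ i }

  sum∘tabulate : (f : Fin n → ℕ) → Vec.sum (tabulate f) ≡ ∑[ i < n ] f i
  sum∘tabulate {zero}  f = refl
  sum∘tabulate {suc n} f = cong (f zero +_) (sum∘tabulate (f ∘ suc))

  𝟙 : Bool → ℕ
  𝟙 true  = 1
  𝟙 false = 0

  𝟙-∧ : ∀ x y → 𝟙 (x ∧ y) ≡ 𝟙 x * 𝟙 y
  𝟙-∧ true  y = sym (*-identityˡ (𝟙 y))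
  𝟙-∧ false y = refl

  χ : Subset n → Fin n → ℕ
  χ p i = 𝟙 (lookup p i)

  χ-∈ : {p : Subset n} {i : Fin n} → i ∈ p → χ p i ≡ 1
  χ-∈ i∈p = cong 𝟙 ([]=⇒lookup i∈p)

  χ-∉ : {p : Subset n} {i : Fin n} → i ∉ p → χ p i ≡ 0
  χ-∉ {p = p} {i} i∉p with lookup p i in eq
  ... | true  = contradiction (lookup⇒[]= i p eq) i∉p
  ... | false = refl

  χ-∩ : (p q : Subset n) (i : Fin n) → χ (p ∩ q) i ≡ χ p i * χ q i
  χ-∩ p q i = trans (cong 𝟙 (lookup-zipWith _∧_ i p q)) (𝟙-∧ (lookup p i) (lookup q i))

  χ∁+χ≡1 : (p : Subset n) (i : Fin n) → χ (∁ p) i + χ p i ≡ 1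
  χ∁+χ≡1 p i rewrite lookup-map i not p with lookup p i
  ... | true  = refl
  ... | false = refl

  χ∁*+χ*≡ : (p : Subset n) (i : Fin n) (x : ℕ) → χ (∁ p) i * x + χ p i * x ≡ x
  χ∁*+χ*≡ p i x =
    trans (sym (*-distribʳ-+ x (χ (∁ p) i) (χ p i))) (trans (cong (_* x) (χ∁+χ≡1 p i)) (*-identityˡ x))

  χ∁*+χ*-∈ : {p : Subset n} {i : Fin n} (x y : ℕ) → i ∈ p → χ (∁ p) i * x + χ p i * y ≡ y
  χ∁*+χ*-∈ x y i∈p rewrite χ-∉ (x∈p⇒x∉∁p i∈p) | χ-∈ i∈p = +-identityʳ y

  χ∁*+χ*-∉ : {p : Subset n} {i : Fin n} (x y : ℕ) → i ∉ p → χ (∁ p) i * x + χ p i * y ≡ x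
  χ∁*+χ*-∉ x y i∉p rewrite χ-∈ (x∉p⇒x∈∁p i∉p) | χ-∉ i∉p = trans (+-identityʳ _) (+-identityʳ x)

  ∣p∣≡∑χ : (p : Subset n) → ∣ p ∣ ≡ ∑[ i < n ] χ p i
  ∣p∣≡∑χ []            = refl
  ∣p∣≡∑χ (inside  ∷ p) = cong suc (∣p∣≡∑χ p)
  ∣p∣≡∑χ (outside ∷ p) = ∣p∣≡∑χ p

  ∑χ*≡∣p∣* : (p : Subset n) (c : ℕ) → ∑[ i < n ] (χ p i * c) ≡ ∣ p ∣ * c
  ∑χ*≡∣p∣* {n} p c = sym (trans (cong (_* c) (∣p∣≡∑χ p)) (*-distribʳ-sum {n} c (χ p)))

  ∣p∩q∣≡∑χχ : (p q : Subset n) → ∣ p ∩ q ∣ ≡ ∑[ i < n ] (χ p i * χ q i)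
  ∣p∩q∣≡∑χχ p q = trans (∣p∣≡∑χ (p ∩ q)) (sum-cong-≗ (χ-∩ p q))

  ∣tabulate∣≡∑𝟙 : (f : Fin n → Bool) → ∣ tabulate f ∣ ≡ ∑[ i < n ] 𝟙 (f i)
  ∣tabulate∣≡∑𝟙 f = trans (∣p∣≡∑χ (tabulate f)) (sum-cong-≗ (cong 𝟙 ∘ lookup∘tabulate f))

  ∣p∣≡∣p∩q∣+∣p∩∁q∣ : (p q : Subset n) → ∣ p ∣ ≡ ∣ p ∩ q ∣ + ∣ p ∩ ∁ q ∣
  ∣p∣≡∣p∩q∣+∣p∩∁q∣ []            []            = refl
  ∣p∣≡∣p∩q∣+∣p∩∁q∣ (outside ∷ p) (_       ∷ q) = ∣p∣≡∣p∩q∣+∣p∩∁q∣ p q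
  ∣p∣≡∣p∩q∣+∣p∩∁q∣ (inside  ∷ p) (inside  ∷ q) = cong suc (∣p∣≡∣p∩q∣+∣p∩∁q∣ p q)
  ∣p∣≡∣p∩q∣+∣p∩∁q∣ (inside  ∷ p) (outside ∷ q) =
    trans (cong suc (∣p∣≡∣p∩q∣+∣p∩∁q∣ p q)) (sym (+-suc ∣ p ∩ q ∣ ∣ p ∩ ∁ q ∣))

  ∣⁅x⁆∪p∩q∣≡χ+∣p∩q∣ : {x : Fin n} (p q : Subset n) → x ∉ p → ∣ (⁅ x ⁆ ∪ p) ∩ q ∣ ≡ χ q x + ∣ p ∩ q ∣
  ∣⁅x⁆∪p∩q∣≡χ+∣p∩q∣ {x = zero}  (inside  ∷ p) (y ∷ q) x∉p = contradiction here x∉p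
  ∣⁅x⁆∪p∩q∣≡χ+∣p∩q∣ {x = zero}  (outside ∷ p) (y ∷ q) x∉p rewrite ∪-identityˡ p with y
  ... | inside  = refl
  ... | outside = refl
  ∣⁅x⁆∪p∩q∣≡χ+∣p∩q∣ {x = suc x} (z ∷ p) (y ∷ q) x∉p with z ∧ y
  ... | inside  = trans (cong suc (∣⁅x⁆∪p∩q∣≡χ+∣p∩q∣ p q (drop-not-there x∉p))) (sym (+-suc (χ q x) ∣ p ∩ q ∣))
  ... | outside = ∣⁅x⁆∪p∩q∣≡χ+∣p∩q∣ p q (drop-not-there x∉p)

  ∣p∣≤1 : (p : Subset n) → (∀ {x y} → x ∈ p → y ∈ p → x ≡ y) → ∣ p ∣ ≤ 1
  ∣p∣≤1 {n} p unique with nonempty? p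
  ... | yes (x , x∈p) =
    subst (∣ p ∣ ≤_) (∣⁅x⁆∣≡1 x) (p⊆q⇒∣p∣≤∣q∣ λ y∈p → subst (_∈ ⁅ x ⁆) (unique x∈p y∈p) (x∈⁅x⁆ x))
  ... | no  empty     = subst (λ q → ∣ q ∣ ≤ 1) (sym (Empty-unique empty)) (subst (_≤ 1) (sym (∣⊥∣≡0 n)) z≤n)

  2≤∣p∣ : {p : Subset n} {x y : Fin n} → x ∈ p → y ∈ p → x ≢ y → 2 ≤ ∣ p ∣
  2≤∣p∣ x∈p y∈p x≢y =
    -- y ∈ p - x, so ∣ p - x - y ∣ < ∣ p - x ∣ < ∣ p ∣.
    ≤-trans (s≤s (≤-trans (s≤s z≤n) (x∈p⇒∣p-x∣<∣p∣ (x∈p∧x≢y⇒x∈p-y y∈p (x≢y ∘ sym))))) (x∈p⇒∣p-x∣<∣p∣ x∈p)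

  p⊆q⇒∣q∣≤∣p∣⇒q⊆p : {p q : Subset n} → p ⊆ q → ∣ q ∣ ≤ ∣ p ∣ → q ⊆ p
  p⊆q⇒∣q∣≤∣p∣⇒q⊆p {p = p} p⊆q ∣q∣≤∣p∣ {x} x∈q with x ∈? p
  ... | yes x∈p = x∈p
  ... | no  x∉p = contradiction ∣q∣≤∣p∣ (<⇒≱ (p⊂q⇒∣p∣<∣q∣ (p⊆q , x , x∈q , x∉p)))

  ∁-involutive : (p : Subset n) → ∁ (∁ p) ≡ p
  ∁-involutive {n} = BooleanAlgebra.¬-involutive (∪-∩-booleanAlgebra n)

  ∣∁p∣+∣p∣≡n : (p : Subset n) → ∣ ∁ p ∣ + ∣ p ∣ ≡ n
  ∣∁p∣+∣p∣≡n p = trans (cong (_+ ∣ p ∣) (∣∁p∣≡n∸∣p∣ p)) (m∸n+n≡m (∣p∣≤n p))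

module PackingCounting where

  open import Data.Bool using (Bool; true; false; _∧_)
  open import Data.Empty using (⊥-elim)
  open import Data.Fin using (Fin; zero; suc; toℕ; _≟_)
  open import Data.Fin.Properties using (toℕ-injective)
  open import Data.Fin.Subset using (Subset; ⁅_⁆; _∩_; ∁; ∣_∣; _∈_; _∉_; _⊆_)
  open import Data.Fin.Subset.Properties
    using (_∈?_; x∈⁅x⁆; x∈⁅y⁆⇒x≡y; x∈p⇒x∉∁p; x∉p⇒x∈∁p; p∩q⊆q; x∈p∩q⁺; x∈p∩q⁻; x∈p∪q⁺; x∈p∪q⁻; p⊆q⇒∣p∣≤∣q∣; ∣p∣≤n)
  open import Data.Nat using (ℕ; zero; suc; _+_; _*_; _≤_; _<ᵇ_; s≤s)
  open import Data.Nat.Properties hiding (_≟_)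
  open import Data.Nat.Tactic.RingSolver using (solve-∀)
  open import Data.Product using (Σ; _×_; _,_; proj₁; proj₂)
  open import Data.Sum using (inj₁; inj₂)
  open import Data.Vec using (tabulate)
  open import Data.Vec.Properties using (lookup∘tabulate; []=⇒lookup; lookup⇒[]=)
  open import Function using (_∘_; _⇔_; mk⇔; Equivalence)
  open import Relation.Binary.PropositionalEquality
  open import Relation.Nullary using (yes; no; contradiction)
  open SubsetCounting

  private variable n : ℕ

  𝟙-<ᵇ-split : ∀ (i j : ℕ) (a : Bool) → (i ≡ j → a ≡ false) → 𝟙 ((j <ᵇ i) ∧ a) + 𝟙 ((i <ᵇ j) ∧ a) ≡ 𝟙 a
  𝟙-<ᵇ-split zero    zero    a loopless rewrite loopless refl = refl
  𝟙-<ᵇ-split zero    (suc j) a loopless = refl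
  𝟙-<ᵇ-split (suc i) zero    a loopless = +-identityʳ (𝟙 a)
  𝟙-<ᵇ-split (suc i) (suc j) a loopless = 𝟙-<ᵇ-split i j a (loopless ∘ cong suc)

  module _ (G : Graph n) where

    ∈N⇔adj : {v w : Fin n} → w ∈ N G v ⇔ adj G v w ≡ true
    ∈N⇔adj {v} {w} = mk⇔ (λ w∈N → trans (sym (lookup∘tabulate (adj G v) w)) ([]=⇒lookup w∈N))
                         (λ vw → lookup⇒[]= w (N G v) (trans (lookup∘tabulate (adj G v) w) vw))

    ∈N-sym : {v w : Fin n} → w ∈ N G v → v ∈ N G w
    ∈N-sym {v} {w} w∈N = Equivalence.from ∈N⇔adj (trans (Graph.sym G w v) (Equivalence.to ∈N⇔adj w∈N))

    ∉N : (v : Fin n) → v ∉ N G v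
    ∉N v v∈N with trans (sym (Equivalence.to ∈N⇔adj v∈N)) (irrefl G v)
    ... | ()

    χN-sym : (v w : Fin n) → χ (N G v) w ≡ χ (N G w) v
    χN-sym v w =
      cong 𝟙 (trans (lookup∘tabulate (adj G v) w) (trans (Graph.sym G v w) (sym (lookup∘tabulate (adj G w) v))))

    handshake : 2 * size G ≡ ∑[ v < n ] deg G v
    handshake = begin
      2 * size G
        ≡⟨ cong (2 *_) size≡below ⟩
      below + (below + 0)
        ≡⟨ cong (below +_) (trans (+-identityʳ below) (sym above≡below)) ⟩
      below + above
        ≡⟨ ∑-distrib-+ (λ i → ∑[ j < n ] before i j) (λ i → ∑[ j < n ] before j i) ⟨
      ∑[ i < n ] (∑[ j < n ] before i j + ∑[ j < n ] before j i)
        ≡⟨ sum-cong-≗ row ⟩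
      ∑[ v < n ] deg G v ∎
      where
      open ≡-Reasoning
      earlierNeighbour : Fin n → Fin n → Bool
      earlierNeighbour i j = (toℕ j <ᵇ toℕ i) ∧ adj G i j
      before : Fin n → Fin n → ℕ
      before i j = 𝟙 (earlierNeighbour i j)
      below above : ℕ
      below = ∑[ i < n ] ∑[ j < n ] before i j
      above = ∑[ i < n ] ∑[ j < n ] before j i
      size≡below : size G ≡ below
      size≡below = trans (sum∘tabulate (λ i → ∣ tabulate (earlierNeighbour i) ∣))
                         (sum-cong-≗ {n} (∣tabulate∣≡∑𝟙 ∘ earlierNeighbour))
      above≡below : above ≡ below
      above≡below = ∑-comm (λ i j → before j i)
      before+after : ∀ i j → before i j + before j i ≡ 𝟙 (adj G i j)
      before+after i j rewrite Graph.sym G j i =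
        𝟙-<ᵇ-split (toℕ i) (toℕ j) (adj G i j)
          (λ i≡j → subst (λ k → adj G i k ≡ false) (toℕ-injective i≡j) (irrefl G i))
      row : ∀ i → ∑[ j < n ] before i j + ∑[ j < n ] before j i ≡ deg G i
      row i = trans (sym (∑-distrib-+ (before i) (λ j → before j i)))
                    (trans (sum-cong-≗ (before+after i)) (sym (∣tabulate∣≡∑𝟙 (adj G i))))

    edges : Subset n → Subset n → ℕ
    edges X Y = ∑[ v < n ] (χ X v * ∣ N G v ∩ Y ∣)

    edges-sym : (X Y : Subset n) → edges X Y ≡ edges Y X
    edges-sym X Y = begin
      ∑[ v < n ] (χ X v * ∣ N G v ∩ Y ∣)
        ≡⟨ sum-cong-≗ (λ v → trans (cong (χ X v *_) (∣p∩q∣≡∑χχ (N G v) Y)) (*-distribˡ-sum {n} (χ X v) _)) ⟩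
      ∑[ v < n ] ∑[ w < n ] (χ X v * (χ (N G v) w * χ Y w))
        ≡⟨ ∑-comm {n} {n} _ ⟩
      ∑[ w < n ] ∑[ v < n ] (χ X v * (χ (N G v) w * χ Y w))
        ≡⟨ sum-cong-≗ (λ w → sum-cong-≗ (λ v → trans (cong (λ a → χ X v * (a * χ Y w)) (χN-sym v w))
                                                    (swap (χ X v) (χ (N G w) v) (χ Y w)))) ⟩
      ∑[ w < n ] ∑[ v < n ] (χ Y w * (χ (N G w) v * χ X v))
        ≡⟨ sum-cong-≗ (λ w → trans (sym (*-distribˡ-sum {n} (χ Y w) _))
                                   (cong (χ Y w *_) (sym (∣p∩q∣≡∑χχ (N G w) X)))) ⟩
      ∑[ w < n ] (χ Y w * ∣ N G w ∩ X ∣) ∎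
      where
      open ≡-Reasoning
      swap : ∀ x a y → x * (a * y) ≡ y * (a * x)
      swap = solve-∀

    ∑∣N∩p∣≡edges∁+edges : (S Y : Subset n) → ∑[ v < n ] ∣ N G v ∩ Y ∣ ≡ edges (∁ S) Y + edges S Y
    ∑∣N∩p∣≡edges∁+edges S Y = trans (sum-cong-≗ (λ v → sym (χ∁*+χ*≡ S v ∣ N G v ∩ Y ∣))) (∑-distrib-+ {n} _ _)

    ∣NC∩p∣≡1+∣N∩p∣ : {v : Fin n} {X : Subset n} → v ∈ X → ∣ NC G v ∩ X ∣ ≡ 1 + ∣ N G v ∩ X ∣
    ∣NC∩p∣≡1+∣N∩p∣ {v} {X} v∈X =
      trans (∣⁅x⁆∪p∩q∣≡χ+∣p∩q∣ (N G v) X (∉N v)) (cong (_+ ∣ N G v ∩ X ∣) (χ-∈ v∈X))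

    ∣NC∩p∣≡∣N∩p∣ : {v : Fin n} {X : Subset n} → v ∉ X → ∣ NC G v ∩ X ∣ ≡ ∣ N G v ∩ X ∣
    ∣NC∩p∣≡∣N∩p∣ {v} {X} v∉X =
      trans (∣⁅x⁆∪p∩q∣≡χ+∣p∩q∣ (N G v) X (∉N v)) (cong (_+ ∣ N G v ∩ X ∣) (χ-∉ v∉X))

    1+∣N∩p∣≤∣p∣ : {v : Fin n} {X : Subset n} → v ∈ X → 1 + ∣ N G v ∩ X ∣ ≤ ∣ X ∣
    1+∣N∩p∣≤∣p∣ {v} {X} v∈X = subst (_≤ ∣ X ∣) (∣NC∩p∣≡1+∣N∩p∣ v∈X) (p⊆q⇒∣p∣≤∣q∣ (p∩q⊆q (NC G v) X))

    1+∣N∩p∣≡∣p∣⇔adjacent : {v : Fin n} {X : Subset n} → v ∈ X →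
      1 + ∣ N G v ∩ X ∣ ≡ ∣ X ∣ ⇔ (∀ w → w ∈ X → v ≢ w → adj G v w ≡ true)
    1+∣N∩p∣≡∣p∣⇔adjacent {v} {X} v∈X = mk⇔ adjacent complete
      where
      full⇒X⊆NC∩X : 1 + ∣ N G v ∩ X ∣ ≡ ∣ X ∣ → X ⊆ NC G v ∩ X
      full⇒X⊆NC∩X eq = p⊆q⇒∣q∣≤∣p∣⇒q⊆p (p∩q⊆q (NC G v) X) (≤-reflexive (trans (sym eq) (sym (∣NC∩p∣≡1+∣N∩p∣ v∈X))))
      adjacent : 1 + ∣ N G v ∩ X ∣ ≡ ∣ X ∣ → ∀ w → w ∈ X → v ≢ w → adj G v w ≡ true
      adjacent eq w w∈X v≢w with x∈p∪q⁻ ⁅ v ⁆ (N G v) (proj₁ (x∈p∩q⁻ (NC G v) X (full⇒X⊆NC∩X eq w∈X)))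
      ... | inj₁ w∈⁅v⁆ = contradiction (sym (x∈⁅y⁆⇒x≡y v w∈⁅v⁆)) v≢w
      ... | inj₂ w∈N   = Equivalence.to ∈N⇔adj w∈N
      adjacent⇒X⊆NC∩X : (∀ w → w ∈ X → v ≢ w → adj G v w ≡ true) → X ⊆ NC G v ∩ X
      adjacent⇒X⊆NC∩X adjacent {w} w∈X with v ≟ w
      ... | yes refl = x∈p∩q⁺ (x∈p∪q⁺ (inj₁ (x∈⁅x⁆ v)) , w∈X)
      ... | no  v≢w  = x∈p∩q⁺ (x∈p∪q⁺ (inj₂ (Equivalence.from ∈N⇔adj (adjacent w w∈X v≢w))) , w∈X)
      complete : (∀ w → w ∈ X → v ≢ w → adj G v w ≡ true) → 1 + ∣ N G v ∩ X ∣ ≡ ∣ X ∣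
      complete adjacent =
        ≤-antisym (1+∣N∩p∣≤∣p∣ v∈X) (subst (∣ X ∣ ≤_) (∣NC∩p∣≡1+∣N∩p∣ v∈X) (p⊆q⇒∣p∣≤∣q∣ (adjacent⇒X⊆NC∩X adjacent)))

    Clique-from-full : {S : Subset n} → (∀ v → v ∈ S → 1 + ∣ N G v ∩ S ∣ ≡ ∣ S ∣) → Clique G S
    Clique-from-full full u w u∈S w∈S u≢w = Equivalence.to (1+∣N∩p∣≡∣p∣⇔adjacent u∈S) (full u u∈S) w w∈S u≢w

    -- G ∈ Ω_k is CliqueSplit G (k ∸ 1) k and G ∈ Σ is CliqueSplit G 1 1.
    IsCliqueSplit : ℕ → ℕ → Subset n → Set
    IsCliqueSplit p q S = Clique G S × (∀ v → v ∉ S → ∣ N G v ∩ ∁ S ∣ ≡ p) × (∀ v → v ∈ S → ∣ N G v ∩ ∁ S ∣ ≡ q)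

    CliqueSplit : ℕ → ℕ → Set
    CliqueSplit p q = Σ (Subset n) (IsCliqueSplit p q)

    DegreeBounded : ℕ → ℕ → Subset n → Set
    DegreeBounded p q S = (∀ v → v ∉ S → ∣ N G v ∩ ∁ S ∣ ≤ p) × (∀ v → v ∈ S → ∣ N G v ∩ ∁ S ∣ ≤ q)

    IsCliqueSplit⇒DegreeBounded : ∀ {p q S} → IsCliqueSplit p q S → DegreeBounded p q S
    IsCliqueSplit⇒DegreeBounded (_ , exact∉ , exact∈) =
      (λ v v∉S → ≤-reflexive (exact∉ v v∉S)) , (λ v v∈S → ≤-reflexive (exact∈ v v∈S))

    LimitedPacking⇔DegreeBounded : ∀ p S → LimitedPacking G (suc p) (∁ S) ⇔ DegreeBounded p (suc p) S
    LimitedPacking⇔DegreeBounded p S = mk⇔ bounded packing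
      where
      bounded : LimitedPacking G (suc p) (∁ S) → DegreeBounded p (suc p) S
      bounded lp = (λ v v∉S → ≤-pred (subst (_≤ suc p) (∣NC∩p∣≡1+∣N∩p∣ (x∉p⇒x∈∁p v∉S)) (lp v)))
                 , (λ v v∈S → subst (_≤ suc p) (∣NC∩p∣≡∣N∩p∣ (x∈p⇒x∉∁p v∈S)) (lp v))
      packing : DegreeBounded p (suc p) S → LimitedPacking G (suc p) (∁ S)
      packing (bounded∉ , bounded∈) v with v ∈? S
      ... | yes v∈S = subst (_≤ suc p) (sym (∣NC∩p∣≡∣N∩p∣ (x∈p⇒x∉∁p v∈S))) (bounded∈ v v∈S)
      ... | no  v∉S = subst (_≤ suc p) (sym (∣NC∩p∣≡1+∣N∩p∣ (x∉p⇒x∈∁p v∉S))) (s≤s (bounded∉ v v∉S))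

    OpenPacking⇔∣N∩p∣≤1 : (B : Subset n) → OpenPacking G B ⇔ (∀ v → ∣ N G v ∩ B ∣ ≤ 1)
    OpenPacking⇔∣N∩p∣≤1 B = mk⇔ atMostOne packing
      where
      atMostOne : OpenPacking G B → ∀ v → ∣ N G v ∩ B ∣ ≤ 1
      atMostOne open-packing v = ∣p∣≤1 (N G v ∩ B) unique
        where
        unique : ∀ {x y} → x ∈ N G v ∩ B → y ∈ N G v ∩ B → x ≡ y
        unique {x} {y} x∈ y∈ with x ≟ y | x∈p∩q⁻ (N G v) B x∈ | x∈p∩q⁻ (N G v) B y∈
        ... | yes x≡y | _ | _ = x≡y
        ... | no  x≢y | x∈N , x∈B | y∈N , y∈B = ⊥-elim (open-packing x y x∈B y∈B x≢y v (∈N-sym x∈N , ∈N-sym y∈N))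
      packing : (∀ v → ∣ N G v ∩ B ∣ ≤ 1) → OpenPacking G B
      packing atMostOne u v u∈B v∈B u≢v w (w∈Nu , w∈Nv) =
        contradiction (atMostOne w) (<⇒≱ (2≤∣p∣ (x∈p∩q⁺ (∈N-sym w∈Nu , u∈B)) (x∈p∩q⁺ (∈N-sym w∈Nv , v∈B)) u≢v))

    OpenPacking⇔DegreeBounded : ∀ S → OpenPacking G (∁ S) ⇔ DegreeBounded 1 1 S
    OpenPacking⇔DegreeBounded S = mk⇔ (λ op → (λ v _ → to op v) , (λ v _ → to op v)) packing
      where
      open Equivalence (OpenPacking⇔∣N∩p∣≤1 (∁ S))
      packing : DegreeBounded 1 1 S → OpenPacking G (∁ S)
      packing (bounded∉ , bounded∈) = from atMostOne
        where
        atMostOne : ∀ v → ∣ N G v ∩ ∁ S ∣ ≤ 1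
        atMostOne v with v ∈? S
        ... | yes v∈S = bounded∈ v v∈S
        ... | no  v∉S = bounded∉ v v∉S

  packingBound : ℕ → ℕ → ℕ → ℕ → ℕ
  packingBound p q L a = L * p + a * (q + q + a)

  module EdgeCount (G : Graph n) (p q : ℕ) (S : Subset n) where

    d∁ dS : Fin n → ℕ
    d∁ v = ∣ N G v ∩ ∁ S ∣
    dS v = ∣ N G v ∩ S ∣

    -- The weights sum to 2m + ∣ S ∣: each edge between S and ∁ S is counted twice from its end in S
    -- instead of once from each end, and every vertex of S adds one.
    weight : Fin n → ℕ
    weight v = χ (∁ S) v * d∁ v + χ S v * (d∁ v + d∁ v + (1 + dS v))

    bound : Fin n → ℕ
    bound v = χ (∁ S) v * p + χ S v * (q + q + ∣ S ∣)

    2m+∣S∣≡∑weight : 2 * size G + ∣ S ∣ ≡ ∑[ v < n ] weight v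
    2m+∣S∣≡∑weight = begin
      2 * size G + ∣ S ∣
        ≡⟨ cong₂ _+_ (handshake G) (∣p∣≡∑χ S) ⟩
      ∑[ v < n ] deg G v + ∑[ v < n ] χ S v
        ≡⟨ cong (_+ ∑[ v < n ] χ S v) ∑deg ⟩
      E∁∁ + ES∁ + (ES∁ + ESS) + ∑[ v < n ] χ S v
        ≡⟨ regroup E∁∁ ES∁ ESS (∑[ v < n ] χ S v) ⟩
      E∁∁ + (ES∁ + ES∁ + (∑[ v < n ] χ S v + ESS))
        ≡⟨ cong (E∁∁ +_) ∑χS*weight ⟨
      E∁∁ + ∑[ v < n ] (χ S v * (d∁ v + d∁ v + (1 + dS v)))
        ≡⟨ ∑-distrib-+ {n} _ _ ⟨
      ∑[ v < n ] weight v ∎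
      where
      open ≡-Reasoning
      E∁∁ E∁S ES∁ ESS : ℕ
      E∁∁ = edges G (∁ S) (∁ S)
      E∁S = edges G (∁ S) S
      ES∁ = edges G S (∁ S)
      ESS = edges G S S
      ∑deg : ∑[ v < n ] deg G v ≡ E∁∁ + ES∁ + (ES∁ + ESS)
      ∑deg = begin
        ∑[ v < n ] deg G v
          ≡⟨ sum-cong-≗ (λ v → trans (∣p∣≡∣p∩q∣+∣p∩∁q∣ (N G v) S) (+-comm (dS v) (d∁ v))) ⟩
        ∑[ v < n ] (d∁ v + dS v)
          ≡⟨ ∑-distrib-+ {n} _ _ ⟩
        ∑[ v < n ] d∁ v + ∑[ v < n ] dS v
          ≡⟨ cong₂ _+_ (∑∣N∩p∣≡edges∁+edges G S (∁ S)) (∑∣N∩p∣≡edges∁+edges G S S) ⟩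
        E∁∁ + ES∁ + (E∁S + ESS)
          ≡⟨ cong (λ e → E∁∁ + ES∁ + (e + ESS)) (edges-sym G (∁ S) S) ⟩
        E∁∁ + ES∁ + (ES∁ + ESS) ∎
      regroup : ∀ a b c s → a + b + (b + c) + s ≡ a + (b + b + (s + c))
      regroup = solve-∀
      ∑χS*weight : ∑[ v < n ] (χ S v * (d∁ v + d∁ v + (1 + dS v))) ≡ ES∁ + ES∁ + (∑[ v < n ] χ S v + ESS)
      ∑χS*weight = begin
        ∑[ v < n ] (χ S v * (d∁ v + d∁ v + (1 + dS v)))
          ≡⟨ sum-cong-≗ (λ v → expand (χ S v) (d∁ v) (dS v)) ⟩
        ∑[ v < n ] (χ S v * d∁ v + χ S v * d∁ v + (χ S v + χ S v * dS v))
          ≡⟨ ∑-distrib-+ {n} _ _ ⟩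
        ∑[ v < n ] (χ S v * d∁ v + χ S v * d∁ v) + ∑[ v < n ] (χ S v + χ S v * dS v)
          ≡⟨ cong₂ _+_ (∑-distrib-+ {n} _ _) (∑-distrib-+ {n} _ _) ⟩
        ES∁ + ES∁ + (∑[ v < n ] χ S v + ESS) ∎
        where
        expand : ∀ x a b → x * (a + a + (1 + b)) ≡ x * a + x * a + (x + x * b)
        expand = solve-∀

    ∑bound : ∑[ v < n ] bound v ≡ packingBound p q ∣ ∁ S ∣ ∣ S ∣
    ∑bound = trans (∑-distrib-+ {n} _ _) (cong₂ _+_ (∑χ*≡∣p∣* (∁ S) p) (∑χ*≡∣p∣* S (q + q + ∣ S ∣)))

    weight-∈ : {v : Fin n} → v ∈ S → weight v ≡ d∁ v + d∁ v + (1 + dS v)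
    weight-∈ = χ∁*+χ*-∈ _ _

    weight-∉ : {v : Fin n} → v ∉ S → weight v ≡ d∁ v
    weight-∉ = χ∁*+χ*-∉ _ _

    bound-∈ : {v : Fin n} → v ∈ S → bound v ≡ q + q + ∣ S ∣
    bound-∈ = χ∁*+χ*-∈ p (q + q + ∣ S ∣)

    bound-∉ : {v : Fin n} → v ∉ S → bound v ≡ p
    bound-∉ = χ∁*+χ*-∉ p (q + q + ∣ S ∣)

    module _ (bounded : DegreeBounded G p q S) where

      private
        bounded∉ : ∀ v → v ∉ S → d∁ v ≤ p
        bounded∉ = proj₁ bounded
        bounded∈ : ∀ v → v ∈ S → d∁ v ≤ q
        bounded∈ = proj₂ bounded

      weight≤bound : ∀ v → weight v ≤ bound v
      weight≤bound v with v ∈? S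
      ... | yes v∈S = subst₂ _≤_ (sym (weight-∈ v∈S)) (sym (bound-∈ v∈S))
                        (+-mono-≤ (+-mono-≤ (bounded∈ v v∈S) (bounded∈ v v∈S)) (1+∣N∩p∣≤∣p∣ G v∈S))
      ... | no  v∉S = subst₂ _≤_ (sym (weight-∉ v∉S)) (sym (bound-∉ v∉S)) (bounded∉ v v∉S)

      ∑weight≡∑bound⇔IsCliqueSplit : ∑[ v < n ] weight v ≡ ∑[ v < n ] bound v ⇔ IsCliqueSplit G p q S
      ∑weight≡∑bound⇔IsCliqueSplit = mk⇔ split attained
        where
        split : ∑[ v < n ] weight v ≡ ∑[ v < n ] bound v → IsCliqueSplit G p q S
        split eq = Clique-from-full G (λ v v∈S → proj₂ (tight-∈ v∈S))
                 , (λ v v∉S → tight-∉ v∉S)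
                 , (λ v v∈S → proj₁ (tight-∈ v∈S))
          where
          tight : ∀ v → weight v ≡ bound v
          tight = ∑-mono-≤-≡⇒≡ weight≤bound eq
          tight-∉ : {v : Fin n} → v ∉ S → d∁ v ≡ p
          tight-∉ {v} v∉S = trans (sym (weight-∉ v∉S)) (trans (tight v) (bound-∉ v∉S))
          tight-∈ : {v : Fin n} → v ∈ S → d∁ v ≡ q × 1 + dS v ≡ ∣ S ∣
          tight-∈ {v} v∈S with +-mono-≤-≡⇒≡ (+-mono-≤ (bounded∈ v v∈S) (bounded∈ v v∈S)) (1+∣N∩p∣≤∣p∣ G v∈S)
                                  (trans (sym (weight-∈ v∈S)) (trans (tight v) (bound-∈ v∈S)))
          ... | d∁+d∁≡q+q , full = proj₁ (+-mono-≤-≡⇒≡ (bounded∈ v v∈S) (bounded∈ v v∈S) d∁+d∁≡q+q) , full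
        attained : IsCliqueSplit G p q S → ∑[ v < n ] weight v ≡ ∑[ v < n ] bound v
        attained (clique , exact∉ , exact∈) = sum-cong-≗ pointwise
          where
          pointwise : ∀ v → weight v ≡ bound v
          pointwise v with v ∈? S
          ... | yes v∈S = trans (weight-∈ v∈S) (trans (cong₂ _+_ (cong₂ _+_ (exact∈ v v∈S) (exact∈ v v∈S))
                            (Equivalence.from (1+∣N∩p∣≡∣p∣⇔adjacent G v∈S) (λ w w∈S v≢w → clique v w v∈S w∈S v≢w)))
                            (sym (bound-∈ v∈S)))
          ... | no  v∉S = trans (weight-∉ v∉S) (trans (exact∉ v v∉S) (sym (bound-∉ v∉S)))

      edgeCount-≤ : 2 * size G + ∣ S ∣ ≤ packingBound p q ∣ ∁ S ∣ ∣ S ∣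
      edgeCount-≤ = subst₂ _≤_ (sym 2m+∣S∣≡∑weight) ∑bound (∑-mono-≤ weight≤bound)

      edgeCount-≡⇔ : 2 * size G + ∣ S ∣ ≡ packingBound p q ∣ ∁ S ∣ ∣ S ∣ ⇔ IsCliqueSplit G p q S
      edgeCount-≡⇔ = mk⇔ (λ eq → to (trans (sym 2m+∣S∣≡∑weight) (trans eq (sym ∑bound))))
                         (λ split → trans 2m+∣S∣≡∑weight (trans (from split) ∑bound))
        where open Equivalence ∑weight≡∑bound⇔IsCliqueSplit

  packingBound-shift : ∀ p q L₀ d a →
    packingBound p q L₀ (d + a) + p * d ≡ packingBound p q (L₀ + d) a + (q + q) * d + (d * d + 2 * a * d)
  packingBound-shift = shift
    where
    shift : ∀ p q L₀ d a →
      L₀ * p + (d + a) * (q + q + (d + a)) + p * d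
        ≡ (L₀ + d) * p + a * (q + q + a) + (q + q) * d + (d * d + 2 * a * d)
    shift = solve-∀

  packingBound-overshoot : ∀ {p q X a L₀} d → 1 + p ≤ q + q →
    X + a ≤ packingBound p q (L₀ + suc d) a → X + (suc d + a) ≢ packingBound p q L₀ (suc d + a)
  packingBound-overshoot {p} {q} {X} {a} {L₀} d 1+p≤2q X+a≤ eq = contradiction (+-cancelˡ-≤ B r 0 B+r≤B+0) λ ()
    where
    open ≤-Reasoning
    e = suc d
    B = packingBound p q (L₀ + e) a + (q + q) * e
    r = e * e + 2 * a * e
    regroup : ∀ X e a p → X + (e + a) + p * e ≡ X + a + (1 + p) * e
    regroup = solve-∀
    B+r≤B+0 : B + r ≤ B + 0
    B+r≤B+0 = begin
      B + r                                   ≡⟨ packingBound-shift p q L₀ e a ⟨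
      packingBound p q L₀ (e + a) + p * e     ≡⟨ cong (_+ p * e) eq ⟨
      X + (e + a) + p * e                     ≡⟨ regroup X e a p ⟩
      X + a + (1 + p) * e                     ≤⟨ +-mono-≤ X+a≤ (*-monoˡ-≤ e 1+p≤2q) ⟩
      B                                       ≡⟨ +-identityʳ B ⟨
      B + 0                                   ∎

  packingBound-unique : ∀ {p q X L a L₀ s} → 1 + p ≤ q + q →
    X + a ≤ packingBound p q L a → X + s ≡ packingBound p q L₀ s → L + a ≡ L₀ + s → L₀ ≤ L → L ≡ L₀
  packingBound-unique {L₀ = L₀} _ _ _ _ L₀≤L with m≤n⇒∃[o]m+o≡n L₀≤L
  ... | zero  , refl = +-identityʳ L₀
  packingBound-unique {q = q} {a = a} {L₀} {s} 1+p≤2q X+a≤ X+s≡ L+a≡L₀+s _ | suc d , refl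
    with +-cancelˡ-≡ L₀ (suc d + a) s (trans (sym (+-assoc L₀ (suc d) a)) L+a≡L₀+s)
  ... | refl = contradiction X+s≡ (packingBound-overshoot {q = q} {L₀ = L₀} d 1+p≤2q X+a≤)

  maxCard≤n : {P : Subset n → Set} {L : ℕ} → IsMaxCard P L → L ≤ n
  maxCard≤n ((B , _ , ∣B∣≡L) , _) = subst (_≤ _) ∣B∣≡L (∣p∣≤n B)

  module _ (G : Graph n) {p q : ℕ} (1+p≤2q : 1 + p ≤ q + q) (P : Subset n → Set)
    (packing⇔bounded : ∀ S → P (∁ S) ⇔ DegreeBounded G p q S) where

    open EdgeCount G p q using (edgeCount-≤; edgeCount-≡⇔)

    maxPacking-bound : ∀ {L a} → IsMaxCard P L → L + a ≡ n →
      2 * size G + a ≤ packingBound p q L a × (2 * size G + a ≡ packingBound p q L a ⇔ CliqueSplit G p q)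
    maxPacking-bound {L} {a} ((B , B∈P , ∣B∣≡L) , maximum) L+a≡n = bound , mk⇔ split optimal
      where
      S = ∁ B
      bounded : DegreeBounded G p q S
      bounded = Equivalence.to (packing⇔bounded S) (subst P (sym (∁-involutive B)) B∈P)
      ∣∁S∣≡L : ∣ ∁ S ∣ ≡ L
      ∣∁S∣≡L = trans (cong ∣_∣ (∁-involutive B)) ∣B∣≡L
      ∣S∣≡a : ∣ S ∣ ≡ a
      ∣S∣≡a = +-cancelˡ-≡ L ∣ S ∣ a
        (trans (+-comm L ∣ S ∣) (trans (cong (∣ S ∣ +_) (sym ∣B∣≡L)) (trans (∣∁p∣+∣p∣≡n B) (sym L+a≡n))))
      bound : 2 * size G + a ≤ packingBound p q L a
      bound = subst₂ (λ l x → 2 * size G + x ≤ packingBound p q l x) ∣∁S∣≡L ∣S∣≡a (edgeCount-≤ S bounded)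
      split : 2 * size G + a ≡ packingBound p q L a → CliqueSplit G p q
      split eq = S , Equivalence.to (edgeCount-≡⇔ S bounded)
                       (subst₂ (λ l x → 2 * size G + x ≡ packingBound p q l x) (sym ∣∁S∣≡L) (sym ∣S∣≡a) eq)
      optimal : CliqueSplit G p q → 2 * size G + a ≡ packingBound p q L a
      optimal (S₀ , split₀) = subst₂ (λ l x → 2 * size G + x ≡ packingBound p q l x) (sym L≡L₀) (sym a≡s) eq₀
        where
        bounded₀ : DegreeBounded G p q S₀
        bounded₀ = IsCliqueSplit⇒DegreeBounded G split₀
        eq₀ : 2 * size G + ∣ S₀ ∣ ≡ packingBound p q ∣ ∁ S₀ ∣ ∣ S₀ ∣
        eq₀ = Equivalence.from (edgeCount-≡⇔ S₀ bounded₀) split₀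
        L+a≡L₀+s : L + a ≡ ∣ ∁ S₀ ∣ + ∣ S₀ ∣
        L+a≡L₀+s = trans L+a≡n (sym (∣∁p∣+∣p∣≡n S₀))
        L≡L₀ : L ≡ ∣ ∁ S₀ ∣
        L≡L₀ = packingBound-unique {q = q} 1+p≤2q bound eq₀ L+a≡L₀+s
                 (maximum (∁ S₀) (Equivalence.from (packing⇔bounded S₀) bounded₀))
        a≡s : a ≡ ∣ S₀ ∣
        a≡s = +-cancelˡ-≡ L a ∣ S₀ ∣ (trans L+a≡L₀+s (cong (_+ ∣ S₀ ∣) (sym L≡L₀)))

open import Data.Nat using (ℕ; _≤_; _∸_)
open import Data.Integer using (ℤ; +_; _+_; _-_; _*_)
open import Data.Product using (_×_)
open import Data.Sum using (_⊎_)
open import Function.Bundles using (_⇔_)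

import Data.Integer as ℤ
import Data.Nat as ℕ
import Data.Nat.Properties as ℕ
open import Data.Integer using (0ℤ; +≤+)
open import Data.Integer.Properties
  using (pos-+; pos-*; 0≤i-j⇒j≤i; i-j≡0⇒i≡j; i*j≡0⇒i≡0∨j≡0; +-inverseʳ; +-injective; *-zeroʳ)
open import Data.Integer.Tactic.RingSolver using (solve-∀)
open import Data.Nat using (suc; z≤n; s≤s)
open import Data.Product using (_,_)
open import Data.Sum using (inj₂)
open import Function.Bundles using (mk⇔; Equivalence)
open import Relation.Binary.PropositionalEquality using (_≡_; refl; sym; trans; cong; cong₂; subst)
open import Data.Fin.Subset using (Subset; ∁)
open PackingCounting
  using (DegreeBounded; CliqueSplit; packingBound; maxCard≤n; maxPacking-bound;
         LimitedPacking⇔DegreeBounded; OpenPacking⇔DegreeBounded)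

+[m+n]-m≡+n : ∀ m n → + (m ℕ.+ n) - + m ≡ + n
+[m+n]-m≡+n m n = trans (cong (_- + m) (pos-+ m n)) (cancel (+ m) (+ n))
  where
  cancel : ∀ i j → i + j - i ≡ j
  cancel = solve-∀

sqrt-bound : ∀ {r b : ℤ} {X Y : ℕ} {Q : Set} (c : ℕ) → 0ℤ ℤ.≤ b × b * b - r ≡ + suc c * (+ Y - + X) →
  X ≤ Y × (X ≡ Y ⇔ Q) → SqrtLe r b × (SqrtEq r b ⇔ Q)
sqrt-bound {r} {b} {X} {Y} c (0≤b , gap) (X≤Y , X≡Y⇔Q) =
  (0≤b , r≤b²) ,
  mk⇔ (λ (_ , r≡b²) → Equivalence.to X≡Y⇔Q (tight r≡b²)) (λ q → 0≤b , exact (Equivalence.from X≡Y⇔Q q))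
  where
  r≤b² : r ℤ.≤ b * b
  r≤b² with ℕ.m≤n⇒∃[o]m+o≡n X≤Y
  ... | d , refl = 0≤i-j⇒j≤i (subst (0ℤ ℤ.≤_) (sym gap′) (+≤+ z≤n))
    where
    gap′ : b * b - r ≡ + (suc c ℕ.* d)
    gap′ = trans gap (trans (cong (+ suc c *_) (+[m+n]-m≡+n X d)) (sym (pos-* (suc c) d)))
  tight : r ≡ b * b → X ≡ Y
  tight r≡b² with i*j≡0⇒i≡0∨j≡0 (+ suc c) (trans (sym gap) (trans (cong (b * b -_) r≡b²) (+-inverseʳ (b * b))))
  ... | inj₂ Y-X≡0 = sym (+-injective (i-j≡0⇒i≡j (+ Y) (+ X) Y-X≡0))
  exact : X ≡ Y → r ≡ b * b
  exact refl =
    sym (i-j≡0⇒i≡j (b * b) r (trans gap (trans (cong (+ suc c *_) (+-inverseʳ (+ X))) (*-zeroʳ (+ suc c)))))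

pos-packingBound : ∀ p q L a → + packingBound p q L a ≡ + L * + p + + a * (+ q + + q + + a)
pos-packingBound p q L a =
  trans (pos-+ (L ℕ.* p) _) (cong₂ _+_ (pos-* L p)
    (trans (pos-* a _) (cong (+ a *_) (trans (pos-+ (q ℕ.+ q) a) (cong (_+ + a) (pos-+ q q))))))

pos-2*m+n : ∀ m n → + (2 ℕ.* m ℕ.+ n) ≡ + 2 * + m + + n
pos-2*m+n m n = trans (pos-+ (2 ℕ.* m) n) (cong (_+ + n) (pos-* 2 m))

maxPacking-sqrtBound : ∀ {n} (G : Graph n) {p q : ℕ} → 1 ℕ.+ p ≤ q ℕ.+ q → (P : Subset n → Set) →
  (∀ S → P (∁ S) ⇔ DegreeBounded G p q S) → ∀ {L} → IsMaxCard P L → (r b : ℤ) (c : ℕ) →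
  (∀ a → L ℕ.+ a ≡ n → 0ℤ ℤ.≤ b × b * b - r ≡ + suc c * (+ packingBound p q L a - + (2 ℕ.* size G ℕ.+ a))) →
  SqrtLe r b × (SqrtEq r b ⇔ CliqueSplit G p q)
maxPacking-sqrtBound {n} G 1+p≤2q P packing⇔bounded {L} maxL r b c gap =
  sqrt-bound c (gap (n ∸ L) L+a≡n) (maxPacking-bound G 1+p≤2q P packing⇔bounded maxL L+a≡n)
  where
  L+a≡n : L ℕ.+ (n ∸ L) ≡ n
  L+a≡n = ℕ.m+[n∸m]≡n (maxCard≤n maxL)

limitedPacking-identities : ∀ (k n L a m p Y X : ℤ) → k ≡ + 1 + p → n ≡ L + a →
  Y ≡ L * p + a * (k + k + a) → X ≡ + 2 * m + a →
  + 2 * n + k - + 2 * L ≡ + 2 * a + k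
  × (+ 2 * n + k - + 2 * L) * (+ 2 * n + k - + 2 * L) - (k * k + + 4 * n - + 4 * k * n + + 8 * m) ≡ + 4 * (Y - X)
limitedPacking-identities _ _ L a m p _ _ refl refl refl refl = shift L a p , square L a m p
  where
  shift : ∀ L a p → + 2 * (L + a) + (+ 1 + p) - + 2 * L ≡ + 2 * a + (+ 1 + p)
  shift = solve-∀
  square : ∀ L a m p →
    (+ 2 * (L + a) + (+ 1 + p) - + 2 * L) * (+ 2 * (L + a) + (+ 1 + p) - + 2 * L)
      - ((+ 1 + p) * (+ 1 + p) + + 4 * (L + a) - + 4 * (+ 1 + p) * (L + a) + + 8 * m)
    ≡ + 4 * ((L * p + a * ((+ 1 + p) + (+ 1 + p) + a)) - (+ 2 * m + a))
  square = solve-∀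

openPacking-identities : ∀ (n L a m Y X : ℤ) → n ≡ L + a → Y ≡ L * + 1 + a * (+ 1 + + 1 + a) → X ≡ + 2 * m + a →
  n - L ≡ a × (n - L) * (n - L) - (+ 2 * m - n) ≡ + 1 * (Y - X)
openPacking-identities _ L a m _ _ refl refl refl = shift L a , square L a m
  where
  shift : ∀ L a → L + a - L ≡ a
  shift = solve-∀
  square : ∀ L a m →
    (L + a - L) * (L + a - L) - (+ 2 * m - (L + a)) ≡ + 1 * ((L * + 1 + a * (+ 1 + + 1 + a)) - (+ 2 * m + a))
  square = solve-∀

limitedPacking-gap : ∀ {n} m p L a → L ℕ.+ a ≡ n →
  0ℤ ℤ.≤ + 2 * + n + + suc p - + 2 * + L
  × (+ 2 * + n + + suc p - + 2 * + L) * (+ 2 * + n + + suc p - + 2 * + L)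
      - (+ suc p * + suc p + + 4 * + n - + 4 * + suc p * + n + + 8 * + m)
    ≡ + 4 * (+ packingBound p (suc p) L a - + (2 ℕ.* m ℕ.+ a))
limitedPacking-gap {n} m p L a L+a≡n
  with limitedPacking-identities (+ suc p) (+ n) (+ L) (+ a) (+ m) (+ p) _ _ (pos-+ 1 p)
         (trans (cong +_ (sym L+a≡n)) (pos-+ L a)) (pos-packingBound p (suc p) L a) (pos-2*m+n m a)
... | b≡2a+k , b²-r≡ = subst (0ℤ ℤ.≤_) (sym (trans b≡2a+k (sym (pos-2*m+n a (suc p))))) (+≤+ z≤n) , b²-r≡

openPacking-gap : ∀ {n} m ρ a → ρ ℕ.+ a ≡ n →
  0ℤ ℤ.≤ + n - + ρ
  × (+ n - + ρ) * (+ n - + ρ) - (+ 2 * + m - + n) ≡ + 1 * (+ packingBound 1 1 ρ a - + (2 ℕ.* m ℕ.+ a))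
openPacking-gap {n} m ρ a ρ+a≡n
  with openPacking-identities (+ n) (+ ρ) (+ a) (+ m) _ _
         (trans (cong +_ (sym ρ+a≡n)) (pos-+ ρ a)) (pos-packingBound 1 1 ρ a) (pos-2*m+n m a)
... | b≡a , b²-r≡ = subst (0ℤ ℤ.≤_) (sym b≡a) (+≤+ z≤n) , b²-r≡

theorem2 : ∀ {n : ℕ} (G : Graph n) →
    -- part 1: k-limited packing bound (multiplied through by 2)
    (∀ (k : ℕ) → 1 ≤ k →
      (SqrtLe (+ 4 * (+ n * + n - + n - + 2 * + size G)) (+ 2 * + n - + k)
        ⊎ (∀ v → k ∸ 1 ≤ deg G v)) →
      ∀ (L : ℕ) → IsMaxCard (LimitedPacking G k) L →
        SqrtLe (+ k * + k + + 4 * + n - + 4 * + k * + n + + 8 * + size G)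
               (+ 2 * + n + + k - + 2 * + L)
        × (SqrtEq (+ k * + k + + 4 * + n - + 4 * + k * + n + + 8 * + size G)
                  (+ 2 * + n + + k - + 2 * + L)
           ⇔ InOmega G k))
    ×
    -- part 2: open packing bound
    ((∀ v → 1 ≤ deg G v) →
      ∀ (ρ : ℕ) → IsMaxCard (OpenPacking G) ρ →
        SqrtLe (+ 2 * + size G - + n) (+ n - + ρ)
        × (SqrtEq (+ 2 * + size G - + n) (+ n - + ρ) ⇔ InSigma G))
theorem2 G =
  (λ { (suc p) _ _ L maxL →
          maxPacking-sqrtBound G (s≤s (ℕ.m≤m+n p (suc p))) _ (LimitedPacking⇔DegreeBounded G p) maxL
            _ _ 3 (limitedPacking-gap (size G) p L) })
  , λ _ ρ maxρ →
      maxPacking-sqrtBound G ℕ.≤-refl _ (OpenPacking⇔DegreeBounded G) maxρ _ _ 0 (openPacking-gap (size G) ρ)
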